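{- Let $\mathcal{G}$ be an ordered group satisfying GOG1. For all $g,h\in\mathcal{G}$: (a) $g^{ -1}\asymp g$; (b) $gh\preccurlyeq g$ or $gh\preccurlyeq h$; (c) if $1\leqslant g\leqslant h$ then $g\preccurlyeq h$.
   Context: An ordered group is a group $(\mathcal{G},\cdot,1)$ with a linear order $<$ such that $g>h$ implies $fg>fh$ and $gf>hf$ for all $f$. $\mathcal{C}(g)=\{h: hg=gh\}$, $\mathcal{G}^{>}=\{f: f>1\}$. GOG1: for all $f,g\in\mathcal{G}^{>}$ with $f\geqslant g$ and all $g_0\in\mathcal{C}(g)$ there is $f_0\in\mathcal{C}(f)$ with $f_0\geqslant g_0$. For $f,g\in\mathcal{G}$: $f\preccurlyeq g$ holds if $f=1$, or if $g\neq 1$ and there are $g_0,g_1\in\mathcal{C}(g)$ with $g_0\leqslant f\leqslant g_1$; $f\asymp g$ means $f\preccurlyeq g$ and $g\preccurlyeq f$. -}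

module Defs where

open import Level using (Level; suc; _⊔_)
open import Algebra.Structures using (IsGroup)
open import Relation.Binary.Structures using (IsStrictTotalOrder)
open import Relation.Binary.PropositionalEquality using (_≡_)
open import Data.Product using (Σ; _×_; _,_)
open import Data.Sum using (_⊎_)

record OrderedGroup (c ℓ : Level) : Set (suc (c ⊔ ℓ)) where
  infixl 7 _∙_
  infix 8 _⁻¹
  infix 4 _<_ _≤_ _≼_ _≍_
  field
    Carrier : Set c
    _∙_ : Carrier → Carrier → Carrier
    ε : Carrier
    _⁻¹ : Carrier → Carrier
    isGroup : IsGroup _≡_ _∙_ ε _⁻¹
    _<_ : Carrier → Carrier → Set ℓ
    isStrictTotalOrder : IsStrictTotalOrder _≡_ _<_
    <-compatˡ : ∀ f {g h} → h < g → (f ∙ h) < (f ∙ g)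
    <-compatʳ : ∀ f {g h} → h < g → (h ∙ f) < (g ∙ f)

  _≤_ : Carrier → Carrier → Set (c ⊔ ℓ)
  x ≤ y = (x < y) ⊎ (x ≡ y)

  C : Carrier → Carrier → Set c
  C g h = h ∙ g ≡ g ∙ h

  _≼_ : Carrier → Carrier → Set (c ⊔ ℓ)
  f ≼ g = (f ≡ ε) ⊎ ((g ≡ ε → Data.Empty.⊥) ×
            Σ Carrier (λ g₀ → Σ Carrier (λ g₁ →
              C g g₀ × C g g₁ × g₀ ≤ f × f ≤ g₁)))
    where import Data.Empty

  _≍_ : Carrier → Carrier → Set (c ⊔ ℓ)
  f ≍ g = (f ≼ g) × (g ≼ f)

  GOG1 : Set (c ⊔ ℓ)
  GOG1 = ∀ f g → ε < f → ε < g → g ≤ f → ∀ g₀ → C g g₀ →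
         Σ Carrier (λ f₀ → C f f₀ × g₀ ≤ f₀)

{-# OPTIONS --safe #-}
-- Every g ≠ 1 has 1, g, g⁻¹ and g² in its centraliser, so each claim comes down
-- to trapping an element between two of these using bi-invariance of the order:
-- for 1 < g ≤ h one has 1 < gh ≤ h², for g ≤ h < 1 one has g² ≤ gh < 1, and if
-- g and h have opposite signs then gh lies between them, while any f between a
-- and b satisfies f ≼ a or f ≼ b according to the sign of f.
module Submission where

open import Defs
open import Algebra.Bundles using (Group)
open import Algebra.Structures using (IsGroup)
import Algebra.Properties.Group as GroupProperties
open import Data.Product using (_×_; _,_)
open import Data.Sum as Sum using (_⊎_; inj₁; inj₂)
open import Relation.Binary.Bundles using (StrictTotalOrder)
open import Relation.Binary.Definitions using (tri<; tri≈; tri>)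
open import Relation.Binary.PropositionalEquality
  using (_≡_; _≢_; refl; sym; trans; cong; subst)
open import Relation.Binary.Structures using (IsStrictTotalOrder)
import Relation.Binary.Construct.StrictToNonStrict as StrictToNonStrict
import Relation.Binary.Properties.StrictTotalOrder as StrictTotalOrderProperties
open import Relation.Nullary using (yes; no)

module OrderedGroupProperties {c ℓ} (G : OrderedGroup c ℓ) where
  open OrderedGroup G
  open IsGroup isGroup using (assoc; identityˡ; identityʳ; inverseˡ; inverseʳ)
  open IsStrictTotalOrder isStrictTotalOrder
    using (compare; _≟_; irrefl; <-respˡ-≈; <-respʳ-≈) renaming (trans to <-trans)

  group : Group c c
  group = record { isGroup = isGroup }

  strictTotalOrder : StrictTotalOrder c c ℓ
  strictTotalOrder = record { isStrictTotalOrder = isStrictTotalOrder }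

  open GroupProperties group using (ε⁻¹≈ε; ⁻¹-involutive)
  open StrictTotalOrderProperties strictTotalOrder using (total)

  private variable
    a b f g h x y z : Carrier

  <-≤-trans : x < y → y ≤ z → x < z
  <-≤-trans = StrictToNonStrict.<-≤-trans _≡_ _<_ <-trans <-respʳ-≈

  ≤-<-trans : x ≤ y → y < z → x < z
  ≤-<-trans = StrictToNonStrict.≤-<-trans _≡_ _<_ sym <-trans <-respˡ-≈

  <ε⇒≢ε : x < ε → x ≢ ε
  <ε⇒≢ε x<ε x≡ε = irrefl x≡ε x<ε

  >ε⇒≢ε : ε < x → x ≢ ε
  >ε⇒≢ε ε<x x≡ε = irrefl (sym x≡ε) ε<x

  ∙-monoˡ-≤ : ∀ f → x ≤ y → f ∙ x ≤ f ∙ y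
  ∙-monoˡ-≤ f = Sum.map (<-compatˡ f) (cong (f ∙_))

  ∙-monoʳ-≤ : ∀ f → x ≤ y → x ∙ f ≤ y ∙ f
  ∙-monoʳ-≤ f = Sum.map (<-compatʳ f) (cong (_∙ f))

  ε<x⇒y<x∙y : ε < x → y < x ∙ y
  ε<x⇒y<x∙y {x = x} {y = y} ε<x = subst (_< x ∙ y) (identityˡ y) (<-compatʳ y ε<x)

  ε<y⇒x<x∙y : ε < y → x < x ∙ y
  ε<y⇒x<x∙y {y = y} {x = x} ε<y = subst (_< x ∙ y) (identityʳ x) (<-compatˡ x ε<y)

  x<ε⇒x∙y<y : x < ε → x ∙ y < y
  x<ε⇒x∙y<y {x = x} {y = y} x<ε = subst (x ∙ y <_) (identityˡ y) (<-compatʳ y x<ε)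

  y<ε⇒x∙y<x : y < ε → x ∙ y < x
  y<ε⇒x∙y<x {y = y} {x = x} y<ε = subst (x ∙ y <_) (identityʳ x) (<-compatˡ x y<ε)

  ∙-positive : ε < x → ε < y → ε < x ∙ y
  ∙-positive ε<x ε<y = <-trans ε<y (ε<x⇒y<x∙y ε<x)

  ∙-negative : x < ε → y < ε → x ∙ y < ε
  ∙-negative x<ε y<ε = <-trans (x<ε⇒x∙y<y x<ε) y<ε

  C-ε : C g ε
  C-ε {g} = trans (identityˡ g) (sym (identityʳ g))

  C-inverse : C g (g ⁻¹)
  C-inverse {g} = trans (inverseˡ g) (sym (inverseʳ g))

  C-square : C g (g ∙ g)
  C-square {g} = assoc g g g

  ∈C⇒≼ : g ≢ ε → C g f → f ≼ g
  ∈C⇒≼ g≢ε f∈Cg = inj₂ (g≢ε , _ , _ , f∈Cg , f∈Cg , inj₂ refl , inj₂ refl)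

  ε≤f≤b⇒f≼g : g ≢ ε → C g b → ε ≤ f → f ≤ b → f ≼ g
  ε≤f≤b⇒f≼g g≢ε b∈Cg ε≤f f≤b = inj₂ (g≢ε , _ , _ , C-ε , b∈Cg , ε≤f , f≤b)

  a≤f≤ε⇒f≼g : g ≢ ε → C g a → a ≤ f → f ≤ ε → f ≼ g
  a≤f≤ε⇒f≼g g≢ε a∈Cg a≤f f≤ε = inj₂ (g≢ε , _ , _ , a∈Cg , C-ε , a≤f , f≤ε)

  ≼-refl : ∀ g → g ≼ g
  ≼-refl g with g ≟ ε
  ... | yes g≡ε = inj₁ g≡ε
  ... | no g≢ε = ∈C⇒≼ g≢ε refl

  ⁻¹-≼ : ∀ g → g ⁻¹ ≼ g
  ⁻¹-≼ g with g ≟ ε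
  ... | yes refl = inj₁ ε⁻¹≈ε
  ... | no g≢ε = ∈C⇒≼ g≢ε C-inverse

  ⁻¹-≍ : ∀ g → g ⁻¹ ≍ g
  ⁻¹-≍ g = ⁻¹-≼ g , subst (_≼ g ⁻¹) (⁻¹-involutive g) (⁻¹-≼ (g ⁻¹))

  ε≤f≤g⇒f≼g : ε ≤ f → f ≤ g → f ≼ g
  ε≤f≤g⇒f≼g (inj₂ refl) _ = inj₁ refl
  ε≤f≤g⇒f≼g (inj₁ ε<f) f≤g =
    ε≤f≤b⇒f≼g (>ε⇒≢ε (<-≤-trans ε<f f≤g)) refl (inj₁ ε<f) f≤g

  g≤f≤ε⇒f≼g : g ≤ f → f ≤ ε → f ≼ g
  g≤f≤ε⇒f≼g _ (inj₂ refl) = inj₁ refl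
  g≤f≤ε⇒f≼g g≤f (inj₁ f<ε) =
    a≤f≤ε⇒f≼g (<ε⇒≢ε (≤-<-trans g≤f f<ε)) refl g≤f (inj₁ f<ε)

  between⇒≼⊎≼ : a ≤ f → f ≤ b → f ≼ a ⊎ f ≼ b
  between⇒≼⊎≼ {f = f} a≤f f≤b with total f ε
  ... | inj₁ f≤ε = inj₁ (g≤f≤ε⇒f≼g a≤f f≤ε)
  ... | inj₂ ε≤f = inj₂ (ε≤f≤g⇒f≼g ε≤f f≤b)

  ∙-≼⊎≼-positive : ε < g → ε < h → g ∙ h ≼ g ⊎ g ∙ h ≼ h
  ∙-≼⊎≼-positive {g} {h} ε<g ε<h with total g h
  ... | inj₁ g≤h =
    inj₂ (ε≤f≤b⇒f≼g (>ε⇒≢ε ε<h) C-square (inj₁ (∙-positive ε<g ε<h)) (∙-monoʳ-≤ h g≤h))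
  ... | inj₂ h≤g =
    inj₁ (ε≤f≤b⇒f≼g (>ε⇒≢ε ε<g) C-square (inj₁ (∙-positive ε<g ε<h)) (∙-monoˡ-≤ g h≤g))

  ∙-≼⊎≼-negative : g < ε → h < ε → g ∙ h ≼ g ⊎ g ∙ h ≼ h
  ∙-≼⊎≼-negative {g} {h} g<ε h<ε with total g h
  ... | inj₁ g≤h =
    inj₁ (a≤f≤ε⇒f≼g (<ε⇒≢ε g<ε) C-square (∙-monoˡ-≤ g g≤h) (inj₁ (∙-negative g<ε h<ε)))
  ... | inj₂ h≤g =
    inj₂ (a≤f≤ε⇒f≼g (<ε⇒≢ε h<ε) C-square (∙-monoʳ-≤ h h≤g) (inj₁ (∙-negative g<ε h<ε)))

  ∙-≼⊎≼ : ∀ g h → g ∙ h ≼ g ⊎ g ∙ h ≼ h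
  ∙-≼⊎≼ g h with compare g ε | compare h ε
  ... | tri≈ _ refl _ | _ = inj₂ (subst (_≼ h) (sym (identityˡ h)) (≼-refl h))
  ... | _ | tri≈ _ refl _ = inj₁ (subst (_≼ g) (sym (identityʳ g)) (≼-refl g))
  ... | tri> _ _ ε<g | tri> _ _ ε<h = ∙-≼⊎≼-positive ε<g ε<h
  ... | tri< g<ε _ _ | tri< h<ε _ _ = ∙-≼⊎≼-negative g<ε h<ε
  ... | tri> _ _ ε<g | tri< h<ε _ _ =
    Sum.swap (between⇒≼⊎≼ (inj₁ (ε<x⇒y<x∙y ε<g)) (inj₁ (y<ε⇒x∙y<x h<ε)))
  ... | tri< g<ε _ _ | tri> _ _ ε<h =
    between⇒≼⊎≼ (inj₁ (ε<y⇒x<x∙y ε<h)) (inj₁ (x<ε⇒x∙y<y g<ε))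

proposition2p4 : ∀ {c ℓ} (G : OrderedGroup c ℓ) → OrderedGroup.GOG1 G →
    let open OrderedGroup G in
    ∀ g h → (g ⁻¹ ≍ g) × (((g ∙ h) ≼ g) ⊎ ((g ∙ h) ≼ h)) × (ε ≤ g → g ≤ h → g ≼ h)
proposition2p4 G _ g h = ⁻¹-≍ g , ∙-≼⊎≼ g h , ε≤f≤g⇒f≼g
  where open OrderedGroupProperties G
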